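{- For any finite abelian group $G$ of order $n\ge 2$ and every positive integer $h\le n-2$, we have $C_h(G)\ge h+1$.
   Context: $G$ is written additively. For $A\subseteq G$ and a positive integer $h$, $h\hat{\;}A$ denotes the set of all sums of $h$ pairwise distinct elements of $A$. $C_h(G)=\max\{|A| : A\subseteq G,\ h\hat{\;}A\neq G\}$. -}

module Defs where

open import Level using (Level; _⊔_)
open import Data.Nat using (ℕ)
open import Data.Fin using (Fin)
open import Data.List using (List; []; _∷_; length; foldr)
open import Data.List.Relation.Unary.All using (All)
open import Data.Product using (Σ; _×_)
open import Algebra.Bundles using (AbelianGroup)
open import Function.Bundles using (Bijection)
open import Relation.Binary.PropositionalEquality using (_≡_)
import Relation.Binary.PropositionalEquality as ≡
import Data.List.Relation.Unary.Unique.Setoid as UniqueS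
import Data.List.Membership.Setoid as MemS

module _ {c ℓ : Level} (G : AbelianGroup c ℓ) where
  open AbelianGroup G

  HasOrder : ℕ → Set (c ⊔ ℓ)
  HasOrder n = Bijection (≡.setoid (Fin n)) setoid

  sumG : List Carrier → Carrier
  sumG = foldr _∙_ ε

  -- A list of pairwise distinct elements (a finite subset of G).
  Distinct : List Carrier → Set (c ⊔ ℓ)
  Distinct = UniqueS.Unique setoid

  _∈A_ : Carrier → List Carrier → Set (c ⊔ ℓ)
  x ∈A A = MemS._∈_ setoid x A

  InRestrictedSumset : ℕ → List Carrier → Carrier → Set (c ⊔ ℓ)
  InRestrictedSumset h A g =
    Σ (List Carrier) λ xs →
      (length xs ≡ h) × All (_∈A A) xs × Distinct xs × (sumG xs ≈ g)

-- Take h + 2 distinct elements t, a₀, …, a_h of G and put A = {a₀, …, a_h}.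
-- A sum of h distinct elements of A omits exactly one a ∈ A, so it equals
-- ΣA − a; hence ΣA − t, which would force a ≈ t ∉ A, is not in h^A.
module Submission where

open import Defs
open import Level using (Level)
open import Data.Nat using (ℕ; suc; _+_; _⊓_; _≤_; _∸_)
open import Data.Nat.Properties
  using (+-comm; +-cancelˡ-≡; suc-injective; m≤n⇒m⊓n≡m; m≤o∸n⇒m+n≤o; ≤-reflexive; ≤-trans)
open import Data.List using (List; []; _∷_; [_]; _++_; length; take; tabulate)
open import Data.List.Properties using (length-++; length-take; length-tabulate; ++-assoc)
open import Data.List.Relation.Unary.All using (All; _∷_)
open import Data.List.Relation.Unary.All.Properties using (All¬⇒¬Any)
open import Data.List.Relation.Unary.AllPairs using (_∷_)
open import Data.List.Relation.Unary.Any using (here)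
open import Data.List.Relation.Unary.Unique.Setoid.Properties using (take⁺; tabulate⁺)
open import Data.List.Membership.Setoid.Properties using (∈-∃++; ∈-++⁻; ∈-++⁺ʳ; ∈-resp-≈)
import Data.List.Relation.Binary.Equality.Setoid as Equality
import Data.List.Relation.Binary.Permutation.Setoid as Permutation
import Data.List.Relation.Binary.Permutation.Setoid.Properties as PermutationProperties
open import Data.Product using (Σ; ∃; _×_; _,_)
open import Data.Sum using (inj₁; inj₂)
open import Relation.Nullary using (¬_; contradiction)
open import Relation.Binary.PropositionalEquality as ≡ using (_≡_)
import Relation.Binary.Reasoning.Setoid as ≈-Reasoning
open import Function.Bundles using (Bijection)
open import Algebra.Bundles using (AbelianGroup)
import Algebra.Properties.Group as GroupProperties

module _ {c ℓ : Level} (G : AbelianGroup c ℓ) where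
  open AbelianGroup G
  open GroupProperties group using (∙-cancelˡ; //-rightDividesˡ)
  open Equality setoid using (≋-refl; ++⁺)
  open Permutation setoid using (_↭_; ↭-refl; ↭-sym; module PermutationReasoning)
  open PermutationProperties setoid using (shift; ∈-resp-↭; xs↭ys⇒|xs|≡|ys|; foldr-commMonoid)

  sumG-++ : ∀ xs ys → sumG G (xs ++ ys) ≈ sumG G xs ∙ sumG G ys
  sumG-++ []       ys = sym (identityˡ (sumG G ys))
  sumG-++ (x ∷ xs) ys = trans (∙-congˡ (sumG-++ xs ys)) (sym (assoc x (sumG G xs) (sumG G ys)))

  sumG-↭ : ∀ {xs ys} → xs ↭ ys → sumG G xs ≈ sumG G ys
  sumG-↭ = foldr-commMonoid isCommutativeMonoid

  Distinct⊆⇒∃-complement : ∀ {A} xs → Distinct G xs → All (λ x → _∈A_ G x A) xs →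
    ∃ λ ys → xs ++ ys ↭ A
  Distinct⊆⇒∃-complement {A} [] _ _ = A , ↭-refl
  Distinct⊆⇒∃-complement (x ∷ xs) (x∉xs ∷ xs-distinct) (x∈A ∷ xs⊆A)
    with ys , xs++ys↭A ← Distinct⊆⇒∃-complement xs xs-distinct xs⊆A
    with ∈-++⁻ setoid xs (∈-resp-↭ (↭-sym xs++ys↭A) x∈A)
  ... | inj₁ x∈xs = contradiction x∈xs (All¬⇒¬Any x∉xs)
  ... | inj₂ x∈ys with us , vs , w , x≈w , ys≋us++w∷vs ← ∈-∃++ setoid x∈ys = us ++ vs , (begin
    x ∷ xs ++ us ++ vs          ≡⟨ ≡.cong (x ∷_) (++-assoc xs us vs) ⟨
    x ∷ (xs ++ us) ++ vs        ↭⟨ shift (sym x≈w) (xs ++ us) vs ⟨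
    (xs ++ us) ++ [ w ] ++ vs   ≡⟨ ++-assoc xs us ([ w ] ++ vs) ⟩
    xs ++ us ++ [ w ] ++ vs     ≋⟨ ++⁺ ≋-refl ys≋us++w∷vs ⟨
    xs ++ ys                    ↭⟨ xs++ys↭A ⟩
    _                           ∎)
    where open PermutationReasoning

  InRestrictedSumset⇒∃-omitted : ∀ {h A g} → length A ≡ suc h → InRestrictedSumset G h A g →
    ∃ λ a → _∈A_ G a A × g ∙ a ≈ sumG G A
  InRestrictedSumset⇒∃-omitted {h} {A} {g} |A|≡1+h (xs , |xs|≡h , xs⊆A , xs-distinct , Σxs≈g) =
    omitted (Distinct⊆⇒∃-complement xs xs-distinct xs⊆A)
    where
    |complement|≡1 : ∀ {ys} → xs ++ ys ↭ A → length ys ≡ 1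
    |complement|≡1 {ys} xs++ys↭A = +-cancelˡ-≡ h (length ys) 1 (begin
      h + length ys          ≡⟨ ≡.cong (_+ length ys) |xs|≡h ⟨
      length xs + length ys  ≡⟨ length-++ xs ⟨
      length (xs ++ ys)      ≡⟨ xs↭ys⇒|xs|≡|ys| xs++ys↭A ⟩
      length A               ≡⟨ |A|≡1+h ⟩
      suc h                  ≡⟨ +-comm 1 h ⟩
      h + 1                  ∎)
      where open ≡.≡-Reasoning

    omitted : (∃ λ ys → xs ++ ys ↭ A) → ∃ λ a → _∈A_ G a A × g ∙ a ≈ sumG G A
    omitted ([] , xs↭A) with () ← |complement|≡1 xs↭A
    omitted (_ ∷ _ ∷ _ , xs++ys↭A) with () ← |complement|≡1 xs++ys↭A
    omitted (a ∷ [] , xs++a↭A) = a , ∈-resp-↭ xs++a↭A (∈-++⁺ʳ setoid xs (here refl)) , (begin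
      g ∙ a                     ≈⟨ ∙-congʳ Σxs≈g ⟨
      sumG G xs ∙ a             ≈⟨ ∙-congˡ (identityʳ a) ⟨
      sumG G xs ∙ sumG G [ a ]  ≈⟨ sumG-++ xs [ a ] ⟨
      sumG G (xs ++ [ a ])      ≈⟨ sumG-↭ xs++a↭A ⟩
      sumG G A                  ∎)
      where open ≈-Reasoning setoid

  ∉RestrictedSumset-sum-minus-outsider : ∀ {h t A} → Distinct G (t ∷ A) → length A ≡ suc h →
    ¬ InRestrictedSumset G h A (sumG G A - t)
  ∉RestrictedSumset-sum-minus-outsider {t = t} {A} (t∉A ∷ _) |A|≡1+h g∈h^A
    with a , a∈A , g∙a≈ΣA ← InRestrictedSumset⇒∃-omitted |A|≡1+h g∈h^A =
    All¬⇒¬Any t∉A (∈-resp-≈ setoid a≈t a∈A)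
    where
    a≈t : a ≈ t
    a≈t = ∙-cancelˡ (sumG G A - t) a t (trans g∙a≈ΣA (sym (//-rightDividesˡ t (sumG G A))))

  HasOrder⇒∃-Distinct-of-length : ∀ {n k} → HasOrder G n → k ≤ n →
    ∃ λ xs → Distinct G xs × length xs ≡ k
  HasOrder⇒∃-Distinct-of-length {n} {k} order k≤n =
    take k (tabulate to) , take⁺ setoid k (tabulate⁺ setoid injective) , (begin
      length (take k (tabulate to))  ≡⟨ length-take k (tabulate to) ⟩
      k ⊓ length (tabulate to)       ≡⟨ ≡.cong (k ⊓_) (length-tabulate to) ⟩
      k ⊓ n                          ≡⟨ m≤n⇒m⊓n≡m k≤n ⟩
      k                              ∎)
    where
    open Bijection order using (to; injective)
    open ≡.≡-Reasoning

proposition2p6 : ∀ {c ℓ : Level} (G : AbelianGroup c ℓ) (n : ℕ) → HasOrder G n → 2 ≤ n →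
    (h : ℕ) → 1 ≤ h → h ≤ n ∸ 2 →
    Σ (List (AbelianGroup.Carrier G)) λ A →
      Distinct G A × (suc h ≤ length A) ×
      Σ (AbelianGroup.Carrier G) λ g → ¬ InRestrictedSumset G h A g
proposition2p6 G n order 2≤n h _ h≤n∸2
  with HasOrder⇒∃-Distinct-of-length G order
         (≤-trans (≤-reflexive (+-comm 2 h)) (m≤o∸n⇒m+n≤o h 2≤n h≤n∸2))
... | [] , _ , ()
... | t ∷ A , tA-distinct@(_ ∷ A-distinct) , |tA|≡2+h =
  A , A-distinct , ≤-reflexive (≡.sym |A|≡1+h) ,
  _ , ∉RestrictedSumset-sum-minus-outsider G tA-distinct |A|≡1+h
  where
  |A|≡1+h : length A ≡ suc h
  |A|≡1+h = suc-injective |tA|≡2+h
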